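{- In the online firefighter game on the infinite square grid $\mathbb{L}_2=\mathbb{Z}\times\mathbb{Z}$, Player 1 has an online strategy that wins against every firefighter sequence $(f_i)_{i\geq 1}$ of non-negative integers revealed by Player 2 which satisfies $$\exists N\geq 1:\ \sum_{i=1}^N f_i\geq 16\, N .$$
   Context: The grid $\mathbb{L}_2$ has vertex set $\mathbb{Z}\times\mathbb{Z}$, with two vertices adjacent iff they differ by exactly $1$ in exactly one coordinate. The firefighter game: at time $0$ a fire breaks out at a given ignition vertex $v$, which becomes burning. At each turn $i=1,2,\dots$, Player 2 reveals the number $f_i\geq 0$ of firefighters available at that turn; Player 1 then chooses at most $f_i$ vertices that are neither burning nor protected and protects them; then the fire spreads from every burning vertex to all of its neighbours that are not protected. Burning and protected vertices stay so forever. Player 2 wins if at every turn some new vertex becomes burning (the fire is never contained); otherwise Player 1 wins. In the online version, Player 1's choices at turn $i$ may depend only on $f_1,\dots,f_i$ and the history of the game so far, not on future values of the sequence. -}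

module Defs where

open import Data.Nat using (ℕ; zero; suc; _≤_; _*_)
open import Data.Integer using (ℤ; _-_; ∣_∣)
open import Data.Product using (_×_; Σ; ∃; ∃-syntax; _,_)
open import Data.Sum using (_⊎_)
open import Data.Empty using (⊥)
open import Data.List using (List; []; _∷_; length; map; upTo; _∷ʳ_)
open import Data.Nat.ListAction using (sum)
open import Data.List.Membership.Propositional using (_∈_)
open import Data.List.Relation.Unary.All using (All)
open import Relation.Nullary using (¬_)
open import Relation.Binary.PropositionalEquality using (_≡_)

Vertex : Set
Vertex = ℤ × ℤ

Adj : Vertex → Vertex → Set
Adj (x₁ , x₂) (y₁ , y₂) =
  (x₁ ≡ y₁ × ∣ x₂ - y₂ ∣ ≡ 1) ⊎ (x₂ ≡ y₂ × ∣ x₁ - y₁ ∣ ≡ 1)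

-- A firefighter sequence, 0-indexed: f t is the paper's f_{t+1}
-- (the number of firefighters at turn t+1).
FSeq : Set
FSeq = ℕ → ℕ

prefix : FSeq → ℕ → List ℕ
prefix f zero = []
prefix f (suc n) = prefix f n ∷ʳ f n

-- An online strategy: at turn t+1 Player 1 sees f_1,…,f_{t+1}
-- (the history of the game is determined by these and the strategy
-- itself) and returns the list of vertices to protect.
Strategy : Set
Strategy = List ℕ → List Vertex

move : Strategy → FSeq → ℕ → List Vertex
move σ f t = σ (prefix f (suc t))

-- Protected / Burning after t turns (turn 0 = ignition only).
Protected : Strategy → FSeq → ℕ → Vertex → Set
Protected σ f zero x = ⊥
Protected σ f (suc t) x = Protected σ f t x ⊎ x ∈ move σ f t

Burning : Vertex → Strategy → FSeq → ℕ → Vertex → Set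
Burning v σ f zero x = x ≡ v
Burning v σ f (suc t) x =
  Burning v σ f t x ⊎
  (¬ Protected σ f (suc t) x × ∃[ y ] (Burning v σ f t y × Adj y x))

LegalAt : Vertex → Strategy → FSeq → ℕ → Set
LegalAt v σ f t =
  length (move σ f t) ≤ f t ×
  All (λ x → ¬ Burning v σ f t x × ¬ Protected σ f t x) (move σ f t)

Player1Wins : Vertex → Strategy → FSeq → Set
Player1Wins v σ f =
  (∀ t → LegalAt v σ f t) ×
  ∃[ t ] (∀ x → Burning v σ f (suc t) x → Burning v σ f t x)

Condition16 : FSeq → Set
Condition16 f = ∃[ N ] (1 ≤ N × 16 * N ≤ sum (map f (upTo N)))

-- Player 1 plays in phases: phase k consists of the moves at turns t with
-- 2^(k-1) ≤ t < 2^k (counting turns from 0; phase 0 is turn 0 alone), and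
-- during phase k Player 1 protects, in a fixed order, the vertices of the
-- L¹-sphere of radius 2^k around the ignition vertex, which the fire cannot
-- reach before turn 2^k.  This sphere has exactly 4·2^k vertices, so if some
-- phase has at least 4·2^k firefighters the sphere is closed in time, the fire
-- is trapped in a finite ball and, growing monotonically, stops.  Otherwise the
-- first 2^K turns carry fewer than 8·2^K firefighters for every K, and choosing
-- K with 2^(K-1) ≤ N - 1 < 2^K contradicts f₁ + … + f_N ≥ 16 N ≥ 8·2^K.
module Submission where

open import Defs
open import Data.Empty using (⊥-elim)
open import Data.Integer as ℤ using (ℤ; -[1+_]; ∣_∣)
import Data.Integer.Properties as ℤ
import Data.Integer.Tactic.RingSolver as ℤ-Solver
open import Data.List
  using (List; []; _∷_; _++_; concat; _∷ʳ_; length; map; filter; take; drop; applyUpTo; upTo; cartesianProduct)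
open import Data.List.Properties
  using (length-++; length-map; length-applyUpTo; length-filter; length-take; take-all; take-[]; map-upTo; applyUpTo-∷ʳ)
open import Data.List.Membership.Propositional using (_∈_; find; lose)
open import Data.List.Membership.Propositional.Properties
open import Data.List.Relation.Unary.All as All using (All; []; _∷_)
import Data.List.Relation.Unary.All.Properties as All
open import Data.List.Relation.Unary.Any using (here; there; any?)
open import Data.Nat as ℕ using (ℕ; zero; suc; z<s; _+_; _*_; _∸_; _^_; _≤_; _<_; _≤′_; z≤n; s≤s; pred)
open import Data.Nat.Properties
open import Data.Nat.ListAction using (sum)
open import Data.Nat.ListAction.Properties using (sum-++)
import Data.Nat.Tactic.RingSolver as ℕ-Solver
open import Data.Product using (Σ; _×_; _,_; proj₁; proj₂; ∃-syntax)
open import Data.Product.Properties using (≡-dec)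
open import Data.Sum using (_⊎_; inj₁; inj₂; [_,_]′)
open import Function using (id)
open import Relation.Binary.Definitions using (DecidableEquality; tri<; tri≈; tri>)
open import Relation.Binary.PropositionalEquality
  using (_≡_; refl; sym; trans; cong; cong₂; subst; module ≡-Reasoning)
open import Relation.Nullary using (Dec; yes; no; ¬_; ¬?)
open import Relation.Nullary.Decidable using (_×-dec_; _⊎-dec_; map′)

_≟ᵥ_ : DecidableEquality Vertex
_≟ᵥ_ = ≡-dec ℤ._≟_ ℤ._≟_

open import Data.List.Membership.DecPropositional _≟ᵥ_ using (_∈?_)

module _ {A : Set} where

  take-+ : ∀ m n (xs : List A) → take (m + n) xs ≡ take m xs ++ take n (drop m xs)
  take-+ zero    n xs       = refl
  take-+ (suc m) n []       = sym (take-[] n)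
  take-+ (suc m) n (x ∷ xs) = cong (x ∷_) (take-+ m n xs)

  length-++-≡ : ∀ (xs : List A) {ys m n} → length xs ≡ m → length ys ≡ n → length (xs ++ ys) ≡ m + n
  length-++-≡ xs p q = trans (length-++ xs) (cong₂ _+_ p q)

  increasing⇒monotone : {P : ℕ → A → Set} → (∀ {t x} → P t x → P (suc t) x) →
                        ∀ {m n x} → m ≤ n → P m x → P n x
  increasing⇒monotone {P} grow {x = x} m≤n = go (≤⇒≤′ m≤n)
    where
    go : ∀ {m n} → m ≤′ n → P m x → P n x
    go ℕ.≤′-refl      p = p
    go (ℕ.≤′-step m≤n) p = grow (go m≤n p)

  -- First find a step after which nothing but y can enter the family; if y does
  -- enter there, restart from that step with the shorter list.
  stabilises : DecidableEquality A → (L : List A) (P : ℕ → A → Set) → (∀ t x → Dec (P t x)) →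
               (∀ {t x} → P t x → P (suc t) x) → (∀ {t x} → P t x → P 0 x ⊎ x ∈ L) →
               ∃[ t ] (∀ x → P (suc t) x → P t x)
  stabilises _≟_ [] P P? grow bounded = 0 , λ x p → [ id , (λ ()) ]′ (bounded p)
  stabilises _≟_ (y ∷ L) P P? grow bounded =
    settle (stabilises _≟_ L Q (λ t x → P? t x ⊎-dec x ≟ y) [ (λ p → inj₁ (grow p)) , inj₂ ]′ boundedQ)
    where
    Q : ℕ → A → Set
    Q t x = P t x ⊎ x ≡ y

    boundedQ : ∀ {t x} → Q t x → Q 0 x ⊎ x ∈ L
    boundedQ (inj₂ x≡y) = inj₁ (inj₂ x≡y)
    boundedQ (inj₁ p) with bounded p
    ... | inj₁ p₀           = inj₁ (inj₁ p₀)
    ... | inj₂ (here x≡y)   = inj₁ (inj₂ x≡y)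
    ... | inj₂ (there x∈L)  = inj₂ x∈L

    settle : ∃[ t ] (∀ x → Q (suc t) x → Q t x) → ∃[ t ] (∀ x → P (suc t) x → P t x)
    settle (t , stable) with P? t y | P? (suc t) y
    ... | yes pty | _ = t , λ x p → [ id , (λ { refl → pty }) ]′ (stable x (inj₁ p))
    ... | no _ | no ¬pt′y = t , λ x p → [ id , (λ { refl → ⊥-elim (¬pt′y p) }) ]′ (stable x (inj₁ p))
    ... | no _ | yes pt′y =
      let s , stable′ = stabilises _≟_ L (λ s → P (s + suc t)) (λ s → P? (s + suc t)) grow boundedAfter
      in s + suc t , stable′
      where
      boundedAfter : ∀ {s x} → P (s + suc t) x → P (suc t) x ⊎ x ∈ L
      boundedAfter p with bounded p
      ... | inj₁ p₀           = inj₁ (increasing⇒monotone {P = P} grow z≤n p₀)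
      ... | inj₂ (here refl)  = inj₁ pt′y
      ... | inj₂ (there x∈L)  = inj₂ x∈L

infixl 6 _⊕_ _⊖_

∥_∥ : ℤ × ℤ → ℕ
∥ a , b ∥ = ∣ a ∣ + ∣ b ∣

_⊖_ : Vertex → Vertex → ℤ × ℤ
(x₁ , x₂) ⊖ (y₁ , y₂) = x₁ ℤ.- y₁ , x₂ ℤ.- y₂

_⊕_ : Vertex → ℤ × ℤ → Vertex
(x₁ , x₂) ⊕ (a , b) = x₁ ℤ.+ a , x₂ ℤ.+ b

dist : Vertex → Vertex → ℕ
dist x y = ∥ x ⊖ y ∥

⊕-⊖ : ∀ v x → v ⊕ (x ⊖ v) ≡ x
⊕-⊖ (v₁ , v₂) (x₁ , x₂) = cong₂ _,_ (i+[j-i]≡j v₁ x₁) (i+[j-i]≡j v₂ x₂)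
  where
  open ℤ-Solver using (solve-∀)
  i+[j-i]≡j : ∀ i j → i ℤ.+ (j ℤ.- i) ≡ j
  i+[j-i]≡j = solve-∀

dist-⊕ : ∀ v p → dist (v ⊕ p) v ≡ ∥ p ∥
dist-⊕ (v₁ , v₂) (a , b) = cong₂ (λ i j → ∣ i ∣ + ∣ j ∣) (i+j-i≡j v₁ a) (i+j-i≡j v₂ b)
  where
  open ℤ-Solver using (solve-∀)
  i+j-i≡j : ∀ i j → i ℤ.+ j ℤ.- i ≡ j
  i+j-i≡j = solve-∀

dist-self : ∀ v → dist v v ≡ 0
dist-self (v₁ , v₂) = cong₂ _+_ (cong ∣_∣ (ℤ.+-inverseʳ v₁)) (cong ∣_∣ (ℤ.+-inverseʳ v₂))

∣i-k∣≤1+∣j-k∣ : ∀ i j k → ∣ j ℤ.- i ∣ ≡ 1 → ∣ i ℤ.- k ∣ ≤ suc ∣ j ℤ.- k ∣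
∣i-k∣≤1+∣j-k∣ i j k ∣j-i∣≡1 = begin
  ∣ i ℤ.- k ∣                    ≡⟨ cong ∣_∣ (ℤ.+-minus-telescope i j k) ⟨
  ∣ (i ℤ.- j) ℤ.+ (j ℤ.- k) ∣    ≤⟨ ℤ.∣i+j∣≤∣i∣+∣j∣ (i ℤ.- j) (j ℤ.- k) ⟩
  ∣ i ℤ.- j ∣ + ∣ j ℤ.- k ∣      ≡⟨ cong (_+ ∣ j ℤ.- k ∣) (trans (ℤ.∣i-j∣≡∣j-i∣ i j) ∣j-i∣≡1) ⟩
  suc ∣ j ℤ.- k ∣                ∎
  where open ≤-Reasoning

dist-Adj : ∀ v {x y} → Adj y x → dist x v ≤ suc (dist y v)
dist-Adj (v₁ , v₂) {x₁ , x₂} {y₁ , y₂} (inj₁ (refl , ∣y₂-x₂∣≡1)) =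
  ≤-trans (+-monoʳ-≤ ∣ y₁ ℤ.- v₁ ∣ (∣i-k∣≤1+∣j-k∣ x₂ y₂ v₂ ∣y₂-x₂∣≡1)) (≤-reflexive (+-suc _ _))
dist-Adj (v₁ , v₂) {x₁ , x₂} {y₁ , y₂} (inj₂ (refl , ∣y₁-x₁∣≡1)) =
  +-monoˡ-≤ ∣ y₂ ℤ.- v₂ ∣ (∣i-k∣≤1+∣j-k∣ x₁ y₁ v₁ ∣y₁-x₁∣≡1)

Adj? : ∀ y x → Dec (Adj y x)
Adj? (y₁ , y₂) (x₁ , x₂) =
  (y₁ ℤ.≟ x₁ ×-dec ∣ y₂ ℤ.- x₂ ∣ ℕ.≟ 1) ⊎-dec (y₂ ℤ.≟ x₂ ×-dec ∣ y₁ ℤ.- x₁ ∣ ℕ.≟ 1)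

-- The four sides of the sphere of radius R, each running from one corner up to,
-- but excluding, the next.
ne nw sw se : ℕ → ℕ → ℤ × ℤ
ne R j = ℤ.+ (R ∸ j) , ℤ.+ j
nw R j = ℤ.- ℤ.+ j , ℤ.+ (R ∸ j)
sw R j = ℤ.- ℤ.+ (R ∸ j) , ℤ.- ℤ.+ j
se R j = ℤ.+ j , ℤ.- ℤ.+ (R ∸ j)

side : (ℕ → ℕ → ℤ × ℤ) → ℕ → List (ℤ × ℤ)
side s R = applyUpTo (s R) R

sides : ℕ → List (List (ℤ × ℤ))
sides R = side ne R ∷ side nw R ∷ side sw R ∷ side se R ∷ []

sphereOffsets : ℕ → List (ℤ × ℤ)
sphereOffsets R = concat (sides R)

length-sphereOffsets : ∀ R → length (sphereOffsets R) ≡ 4 * R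
length-sphereOffsets R =
  length-++-≡ (side ne R) (∣side∣ ne) (length-++-≡ (side nw R) (∣side∣ nw)
    (length-++-≡ (side sw R) (∣side∣ sw) (length-++-≡ (side se R) (∣side∣ se) refl)))
  where
  ∣side∣ : ∀ s → length (side s R) ≡ R
  ∣side∣ s = length-applyUpTo (s R) R

module _ {R j : ℕ} (j≤R : j ≤ R) where

  ∥ne∥ : ∥ ne R j ∥ ≡ R
  ∥ne∥ = m∸n+n≡m j≤R

  ∥nw∥ : ∥ nw R j ∥ ≡ R
  ∥nw∥ = trans (cong (_+ (R ∸ j)) (ℤ.∣-i∣≡∣i∣ (ℤ.+ j))) (m+[n∸m]≡n j≤R)

  ∥sw∥ : ∥ sw R j ∥ ≡ R
  ∥sw∥ = trans (cong₂ _+_ (ℤ.∣-i∣≡∣i∣ (ℤ.+ (R ∸ j))) (ℤ.∣-i∣≡∣i∣ (ℤ.+ j))) (m∸n+n≡m j≤R)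

  ∥se∥ : ∥ se R j ∥ ≡ R
  ∥se∥ = trans (cong (j +_) (ℤ.∣-i∣≡∣i∣ (ℤ.+ (R ∸ j)))) (m+[n∸m]≡n j≤R)

∈-side⁻ : ∀ s {R p} → (∀ {j} → j ≤ R → ∥ s R j ∥ ≡ R) → p ∈ side s R → ∥ p ∥ ≡ R
∈-side⁻ s {R} ∥s∥ p∈ with _ , j<R , refl ← ∈-applyUpTo⁻ (s R) p∈ = ∥s∥ (<⇒≤ j<R)

∈-side⁺ : ∀ s {R j p} → j < R → s R j ≡ p → p ∈ side s R
∈-side⁺ s {R} j<R refl = ∈-applyUpTo⁺ (s R) j<R

∈-sphereOffsets⁻ : ∀ {R p} → p ∈ sphereOffsets R → ∥ p ∥ ≡ R
∈-sphereOffsets⁻ {R} p∈ with ∈-concat⁻′ (sides R) p∈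
... | _ , p∈s , here refl                         = ∈-side⁻ ne ∥ne∥ p∈s
... | _ , p∈s , there (here refl)                 = ∈-side⁻ nw ∥nw∥ p∈s
... | _ , p∈s , there (there (here refl))         = ∈-side⁻ sw ∥sw∥ p∈s
... | _ , p∈s , there (there (there (here refl))) = ∈-side⁻ se ∥se∥ p∈s

∈-sphereOffsets⁺ : ∀ {p} → 1 ≤ ∥ p ∥ → p ∈ sphereOffsets ∥ p ∥
∈-sphereOffsets⁺ {p} 1≤∥p∥ = let _ , p∈s , s∈ = onSomeSide p 1≤∥p∥ in ∈-concat⁺′ p∈s s∈
  where
  onSomeSide : ∀ p → 1 ≤ ∥ p ∥ → ∃[ xs ] (p ∈ xs × xs ∈ sides ∥ p ∥)
  onSomeSide (ℤ.+ suc m , ℤ.+ n) _ = _ ,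
    ∈-side⁺ ne (m<n+m n z<s) (cong (λ i → ℤ.+ i , ℤ.+ n) (m+n∸n≡m (suc m) n)) ,
    here refl
  onSomeSide (ℤ.+ zero , ℤ.+ n) 1≤n = _ ,
    ∈-side⁺ nw 1≤n refl ,
    there (here refl)
  onSomeSide (-[1+ m ] , ℤ.+ suc n) _ = _ ,
    ∈-side⁺ nw (m<m+n (suc m) z<s) (cong (λ i → -[1+ m ] , ℤ.+ i) (m+n∸m≡n (suc m) (suc n))) ,
    there (here refl)
  onSomeSide (-[1+ m ] , ℤ.+ zero) _ = _ ,
    ∈-side⁺ sw z<s (cong (λ i → ℤ.- ℤ.+ i , ℤ.+ 0) (+-identityʳ (suc m))) ,
    there (there (here refl))
  onSomeSide (-[1+ m ] , -[1+ n ]) _ = _ ,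
    ∈-side⁺ sw (m<n+m (suc n) z<s) (cong (λ i → ℤ.- ℤ.+ i , -[1+ n ]) (m+n∸n≡m (suc m) (suc n))) ,
    there (there (here refl))
  onSomeSide (ℤ.+ m , -[1+ n ]) _ = _ ,
    ∈-side⁺ se (m<m+n m z<s) (cong (λ i → ℤ.+ m , ℤ.- ℤ.+ i) (m+n∸m≡n m (suc n))) ,
    there (there (there (here refl)))

sphere : Vertex → ℕ → List Vertex
sphere v R = map (v ⊕_) (sphereOffsets R)

length-sphere : ∀ v R → length (sphere v R) ≡ 4 * R
length-sphere v R = trans (length-map (v ⊕_) (sphereOffsets R)) (length-sphereOffsets R)

∈-sphere⁻ : ∀ v {R x} → x ∈ sphere v R → dist x v ≡ R
∈-sphere⁻ v x∈ with p , p∈ , refl ← ∈-map⁻ (v ⊕_) x∈ = trans (dist-⊕ v p) (∈-sphereOffsets⁻ p∈)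

∈-sphere⁺ : ∀ v {x} → 1 ≤ dist x v → x ∈ sphere v (dist x v)
∈-sphere⁺ v {x} 1≤d = subst (_∈ sphere v (dist x v)) (⊕-⊖ v x) (∈-map⁺ (v ⊕_) (∈-sphereOffsets⁺ 1≤d))

interval : ℕ → List ℤ
interval R = applyUpTo ℤ.+_ (suc R) ++ applyUpTo -[1+_] R

∈-interval : ∀ {R a} → ∣ a ∣ ≤ R → a ∈ interval R
∈-interval {R} {ℤ.+ n}    n≤R = ∈-++⁺ˡ (∈-applyUpTo⁺ ℤ.+_ (s≤s n≤R))
∈-interval {R} { -[1+ n ]} n<R = ∈-++⁺ʳ (applyUpTo ℤ.+_ (suc R)) (∈-applyUpTo⁺ -[1+_] n<R)

ball : Vertex → ℕ → List Vertex
ball v R = map (v ⊕_) (cartesianProduct (interval R) (interval R))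

∈-ball : ∀ v {R x} → dist x v ≤ R → x ∈ ball v R
∈-ball v {R} {x} d≤R = subst (_∈ ball v R) (⊕-⊖ v x) (∈-map⁺ (v ⊕_)
  (∈-cartesianProduct⁺ (∈-interval (≤-trans (m≤m+n _ _) d≤R)) (∈-interval (≤-trans (m≤n+m _ _) d≤R))))

sumRange : (ℕ → ℕ) → ℕ → ℕ → ℕ
sumRange h a zero    = 0
sumRange h a (suc n) = sumRange h a n + h (a + n)

sum-map-upTo : ∀ h n → sum (map h (upTo n)) ≡ sumRange h 0 n
sum-map-upTo h n = trans (cong sum (map-upTo h n)) (sum-applyUpTo n)
  where
  open ≡-Reasoning
  sum-applyUpTo : ∀ n → sum (applyUpTo h n) ≡ sumRange h 0 n
  sum-applyUpTo zero    = refl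
  sum-applyUpTo (suc n) = begin
    sum (applyUpTo h (suc n))         ≡⟨ cong sum (applyUpTo-∷ʳ h n) ⟨
    sum (applyUpTo h n ∷ʳ h n)        ≡⟨ sum-++ (applyUpTo h n) (h n ∷ []) ⟩
    sum (applyUpTo h n) + (h n + 0)   ≡⟨ cong₂ _+_ (sum-applyUpTo n) (+-identityʳ (h n)) ⟩
    sumRange h 0 n + h n              ∎

sumRange-+ : ∀ h a m n → sumRange h a (m + n) ≡ sumRange h a m + sumRange h (a + m) n
sumRange-+ h a m zero    = trans (cong (sumRange h a) (+-identityʳ m)) (sym (+-identityʳ _))
sumRange-+ h a m (suc n) = begin
  sumRange h a (m + suc n)                                         ≡⟨ cong (sumRange h a) (+-suc m n) ⟩
  sumRange h a (m + n) + h (a + (m + n))                           ≡⟨ cong₂ _+_ (sumRange-+ h a m n) (cong h (sym (+-assoc a m n))) ⟩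
  sumRange h a m + sumRange h (a + m) n + h (a + m + n)           ≡⟨ +-assoc (sumRange h a m) _ _ ⟩
  sumRange h a m + (sumRange h (a + m) n + h (a + m + n))         ∎
  where open ≡-Reasoning

sumRange-mono-≤ : ∀ h a {m n} → m ≤ n → sumRange h a m ≤ sumRange h a n
sumRange-mono-≤ h a {m} {n} m≤n = begin
  sumRange h a m                                  ≤⟨ m≤m+n _ _ ⟩
  sumRange h a m + sumRange h (a + m) (n ∸ m)     ≡⟨ sumRange-+ h a m (n ∸ m) ⟨
  sumRange h a (m + (n ∸ m))                      ≡⟨ cong (sumRange h a) (m+[n∸m]≡n m≤n) ⟩
  sumRange h a n                                  ∎
  where open ≤-Reasoning

sumRange-cong : ∀ {h h′} a n → (∀ {j} → j < n → h (a + j) ≡ h′ (a + j)) → sumRange h a n ≡ sumRange h′ a n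
sumRange-cong a zero    _  = refl
sumRange-cong a (suc n) eq = cong₂ _+_ (sumRange-cong a n (λ j<n → eq (m<n⇒m<1+n j<n))) (eq (n<1+n n))

phaseStart : ℕ → ℕ
phaseStart zero    = 0
phaseStart (suc k) = 2 ^ k

phase : ℕ → ℕ
phase zero = 0
phase (suc t) with suc t <? 2 ^ phase t
... | yes _ = phase t
... | no  _ = suc (phase t)

2^k<2^[1+k] : ∀ k → 2 ^ k < 2 ^ suc k
2^k<2^[1+k] k = ^-monoʳ-< 2 (s≤s (s≤s z≤n)) (n<1+n k)

phase-bounds : ∀ t → phaseStart (phase t) ≤ t × t < 2 ^ phase t
phase-bounds zero = z≤n , s≤s z≤n
phase-bounds (suc t) with suc t <? 2 ^ phase t | phase-bounds t
... | yes t+1<2^k | start≤t , _ = m≤n⇒m≤1+n start≤t , t+1<2^k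
... | no  t+1≮2^k | _ , t<2^k   =
  ≤-reflexive (sym 1+t≡2^k) , subst (_< 2 ^ suc (phase t)) (sym 1+t≡2^k) (2^k<2^[1+k] (phase t))
  where
  1+t≡2^k : suc t ≡ 2 ^ phase t
  1+t≡2^k = ≤-antisym t<2^k (≮⇒≥ t+1≮2^k)

phaseStart≤2^k : ∀ k → phaseStart k ≤ 2 ^ k
phaseStart≤2^k zero    = z≤n
phaseStart≤2^k (suc k) = <⇒≤ (2^k<2^[1+k] k)

2^k≤phaseStart : ∀ {k k′} → k < k′ → 2 ^ k ≤ phaseStart k′
2^k≤phaseStart {k′ = suc k′} (s≤s k≤k′) = ^-monoʳ-≤ 2 k≤k′

2^k≤2[1+phaseStart] : ∀ k → 2 ^ k ≤ 2 * suc (phaseStart k)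
2^k≤2[1+phaseStart] zero    = s≤s z≤n
2^k≤2[1+phaseStart] (suc k) = *-monoʳ-≤ 2 (n≤1+n (2 ^ k))

phase-unique : ∀ {t k} → phaseStart k ≤ t → t < 2 ^ k → phase t ≡ k
phase-unique {t} {k} start≤t t<2^k with <-cmp (phase t) k
... | tri≈ _ phase≡k _ = phase≡k
... | tri< phase<k _ _ = ⊥-elim (<⇒≱ (proj₂ (phase-bounds t)) (≤-trans (2^k≤phaseStart phase<k) start≤t))
... | tri> _ _ k<phase = ⊥-elim (<⇒≱ t<2^k (≤-trans (2^k≤phaseStart k<phase) (proj₁ (phase-bounds t))))

2^phase≤2[1+t] : ∀ t → 2 ^ phase t ≤ 2 * suc t
2^phase≤2[1+t] t = ≤-trans (2^k≤2[1+phaseStart] (phase t)) (*-monoʳ-≤ 2 (s≤s (proj₁ (phase-bounds t))))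

phaseBudget : FSeq → ℕ → ℕ
phaseBudget f k = sumRange f (phaseStart k) (2 ^ k ∸ phaseStart k)

Sufficient : FSeq → ℕ → Set
Sufficient f k = 4 * 2 ^ k ≤ phaseBudget f k

sumRange-doubling : ∀ f K → sumRange f 0 (2 ^ suc K) ≡ sumRange f 0 (2 ^ K) + phaseBudget f (suc K)
sumRange-doubling f K =
  trans (cong (sumRange f 0) (sym (m+[n∸m]≡n (phaseStart≤2^k (suc K))))) (sumRange-+ f 0 (2 ^ K) _)

sufficient-or-sumRange< : ∀ f K → (∃[ k ] Sufficient f k) ⊎ sumRange f 0 (2 ^ K) < 8 * 2 ^ K
sufficient-or-sumRange< f zero with 4 ≤? f 0
... | yes enough = inj₁ (0 , enough)
... | no  short  = inj₂ (≤-trans (≰⇒> short) (m≤m+n 4 4))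
sufficient-or-sumRange< f (suc K) with sufficient-or-sumRange< f K | 4 * 2 ^ suc K ≤? phaseBudget f (suc K)
... | inj₁ found | _          = inj₁ found
... | inj₂ _     | yes enough = inj₁ (suc K , enough)
... | inj₂ small | no  short  = inj₂ (begin-strict
  sumRange f 0 (2 ^ suc K)                      ≡⟨ sumRange-doubling f K ⟩
  sumRange f 0 (2 ^ K) + phaseBudget f (suc K)  <⟨ +-mono-< small (≰⇒> short) ⟩
  8 * 2 ^ K + 4 * (2 * 2 ^ K)                   ≡⟨ 8P+4[2P]≡8[2P] (2 ^ K) ⟩
  8 * 2 ^ suc K                                 ∎)
  where
  open ≤-Reasoning
  open ℕ-Solver using (solve-∀)
  8P+4[2P]≡8[2P] : ∀ P → 8 * P + 4 * (2 * P) ≡ 8 * (2 * P)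
  8P+4[2P]≡8[2P] = solve-∀

sufficient-phase : ∀ f → Condition16 f → ∃[ k ] Sufficient f k
sufficient-phase f (zero , () , _)
sufficient-phase f (suc t , _ , 16N≤Σ) with sufficient-or-sumRange< f (phase t)
... | inj₁ found = found
... | inj₂ small = ⊥-elim (<⇒≱ small (begin
  8 * 2 ^ phase t                 ≤⟨ *-monoʳ-≤ 8 (2^phase≤2[1+t] t) ⟩
  8 * (2 * suc t)                 ≡⟨ *-assoc 8 2 (suc t) ⟨
  16 * suc t                      ≤⟨ 16N≤Σ ⟩
  sum (map f (upTo (suc t)))      ≡⟨ sum-map-upTo f (suc t) ⟩
  sumRange f 0 (suc t)            ≤⟨ sumRange-mono-≤ f 0 (proj₂ (phase-bounds t)) ⟩
  sumRange f 0 (2 ^ phase t)      ∎))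
  where open ≤-Reasoning

nth : List ℕ → ℕ → ℕ
nth []       _       = 0
nth (x ∷ _)  zero    = x
nth (_ ∷ xs) (suc i) = nth xs i

nth-∷ʳ : ∀ xs y {i} → i < length xs → nth (xs ∷ʳ y) i ≡ nth xs i
nth-∷ʳ (x ∷ xs) y {zero}  _         = refl
nth-∷ʳ (x ∷ xs) y {suc i} (s≤s i<n) = nth-∷ʳ xs y i<n

nth-∷ʳ-length : ∀ xs y → nth (xs ∷ʳ y) (length xs) ≡ y
nth-∷ʳ-length []       y = refl
nth-∷ʳ-length (x ∷ xs) y = nth-∷ʳ-length xs y

length-prefix : ∀ f n → length (prefix f n) ≡ n
length-prefix f zero    = refl
length-prefix f (suc n) = trans (length-++-≡ (prefix f n) (length-prefix f n) refl) (+-comm n 1)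

nth-prefix : ∀ f {n i} → i < n → nth (prefix f n) i ≡ f i
nth-prefix f {suc n} {i} (s≤s i≤n) with m≤n⇒m<n∨m≡n i≤n
... | inj₁ i<n  = trans (nth-∷ʳ (prefix f n) (f n) (subst (i <_) (sym (length-prefix f n)) i<n)) (nth-prefix f i<n)
... | inj₂ refl = subst (λ j → nth (prefix f (suc i)) j ≡ f i) (length-prefix f i) (nth-∷ʳ-length (prefix f i) (f i))

module Fire (v : Vertex) (σ : Strategy) (f : FSeq) where

  Protected-mono : ∀ {m n x} → m ≤ n → Protected σ f m x → Protected σ f n x
  Protected-mono = increasing⇒monotone {P = Protected σ f} inj₁

  Burning⇒dist≤ : ∀ {t x} → Burning v σ f t x → dist x v ≤ t
  Burning⇒dist≤ {zero}  refl                      = ≤-reflexive (dist-self v)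
  Burning⇒dist≤ {suc t} (inj₁ b)                  = m≤n⇒m≤1+n (Burning⇒dist≤ b)
  Burning⇒dist≤ {suc t} (inj₂ (_ , y , by , y~x)) = ≤-trans (dist-Adj v y~x) (s≤s (Burning⇒dist≤ by))

  Burning⇒dist< : ∀ {R} → 1 ≤ R → (∀ x → dist x v ≡ R → Protected σ f R x) →
                  ∀ {t x} → Burning v σ f t x → dist x v < R
  Burning⇒dist< {R} 1≤R fence {zero} refl = subst (_< R) (sym (dist-self v)) 1≤R
  Burning⇒dist< 1≤R fence {suc t} (inj₁ b) = Burning⇒dist< 1≤R fence b
  Burning⇒dist< {R} 1≤R fence {suc t} {x} b@(inj₂ (¬p , y , by , y~x))
    with m≤n⇒m<n∨m≡n (≤-trans (dist-Adj v y~x) (Burning⇒dist< 1≤R fence by))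
  ... | inj₁ d<R = d<R
  ... | inj₂ d≡R with R ≤? suc t
  ...   | yes R≤1+t = ⊥-elim (¬p (Protected-mono R≤1+t (fence x d≡R)))
  ...   | no  R≰1+t = ≤-<-trans (Burning⇒dist≤ b) (≰⇒> R≰1+t)

  -- A burning neighbour of x at turn t lies within distance t of v, hence in a finite ball.
  Burning? : (∀ t x → Dec (Protected σ f t x)) → ∀ t x → Dec (Burning v σ f t x)
  Burning? P? zero    x = x ≟ᵥ v
  Burning? P? (suc t) x = Burning? P? t x ⊎-dec (¬? (P? (suc t) x) ×-dec burningNeighbour?)
    where
    burningNeighbour? : Dec (∃[ y ] (Burning v σ f t y × Adj y x))
    burningNeighbour? with any? (λ y → Burning? P? t y ×-dec Adj? y x) (ball v t)
    ... | yes found = yes (let y , _ , by×y~x = find found in y , by×y~x)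
    ... | no  none  = no λ (y , by , y~x) → none (lose (∈-ball v (Burning⇒dist≤ by)) (by , y~x))

  fenced⇒wins : (∀ t → LegalAt v σ f t) → (∀ t x → Dec (Protected σ f t x)) →
                ∀ {R} → 1 ≤ R → (∀ x → dist x v ≡ R → Protected σ f R x) → Player1Wins v σ f
  fenced⇒wins legal P? {R} 1≤R fence =
    legal , stabilises _≟ᵥ_ (ball v R) (Burning v σ f) (Burning? P?) inj₁
              (λ b → inj₂ (∈-ball v (<⇒≤ (Burning⇒dist< 1≤R fence b))))

module SphereStrategy (v : Vertex) where

  -- In phase k, turn t protects the next h t vertices of the sphere of radius 2^k,
  -- after the ones allotted to the earlier turns of the phase.
  offsetIn : (ℕ → ℕ) → ℕ → ℕ → ℕ
  offsetIn h k t = sumRange h (phaseStart k) (t ∸ phaseStart k)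

  segmentIn : (ℕ → ℕ) → ℕ → ℕ → List Vertex
  segmentIn h k t = take (h t) (drop (offsetIn h k t) (sphere v (2 ^ k)))

  segment : (ℕ → ℕ) → ℕ → List Vertex
  segment h t = segmentIn h (phase t) t

  earlier : (ℕ → ℕ) → ℕ → List Vertex
  earlier h zero    = []
  earlier h (suc t) = earlier h t ++ segment h t

  new? : ∀ h t x → Dec (¬ x ∈ earlier h t)
  new? h t x = ¬? (x ∈? earlier h t)

  -- Segments of different turns are in fact disjoint, but discarding earlier
  -- choices makes legality immediate.
  response : (ℕ → ℕ) → ℕ → List Vertex
  response h t = filter (new? h t) (segment h t)

  σ : Strategy
  σ fs = response (nth fs) (pred (length fs))

  Agree : (ℕ → ℕ) → (ℕ → ℕ) → ℕ → Set
  Agree h h′ n = ∀ {i} → i < n → h i ≡ h′ i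

  segment-cong : ∀ {h h′} t → Agree h h′ (suc t) → segment h t ≡ segment h′ t
  segment-cong t agree =
    cong₂ (λ m c → take m (drop c (sphere v (2 ^ k)))) (agree (n<1+n t))
      (sumRange-cong (phaseStart k) (t ∸ phaseStart k) (λ j<Δ → agree (m<n⇒m<1+n (offset< j<Δ))))
    where
    k = phase t
    offset< : ∀ {j} → j < t ∸ phaseStart k → phaseStart k + j < t
    offset< j<Δ = subst (phaseStart k + _ <_) (m+[n∸m]≡n (proj₁ (phase-bounds t))) (+-monoʳ-< (phaseStart k) j<Δ)

  earlier-cong : ∀ {h h′} t → Agree h h′ t → earlier h t ≡ earlier h′ t
  earlier-cong zero    _     = refl
  earlier-cong (suc t) agree = cong₂ _++_ (earlier-cong t (λ i<t → agree (m<n⇒m<1+n i<t))) (segment-cong t agree)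

  response-cong : ∀ {h h′} t → Agree h h′ (suc t) → response h t ≡ response h′ t
  response-cong t agree = cong₂ (λ E S → filter (λ x → ¬? (x ∈? E)) S)
    (earlier-cong t (λ i<t → agree (m<n⇒m<1+n i<t))) (segment-cong t agree)

  move-σ : ∀ f t → move σ f t ≡ response f t
  move-σ f t = trans (cong (λ n → response (nth (prefix f (suc t))) (pred n)) (length-prefix f (suc t)))
    (response-cong t (nth-prefix f))

  segment-dist : ∀ h t → All (λ x → dist x v ≡ 2 ^ phase t) (segment h t)
  segment-dist h t = All.take⁺ (h t) (All.drop⁺ (offsetIn h (phase t) t) (All.tabulate (∈-sphere⁻ v)))

  segment-in-phase : ∀ h k {n} → phaseStart k + n < 2 ^ k →
    segment h (phaseStart k + n) ≡ take (h (phaseStart k + n)) (drop (sumRange h (phaseStart k) n) (sphere v (2 ^ k)))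
  segment-in-phase h k {n} t<2^k = trans
    (cong (λ k′ → segmentIn h k′ t) (phase-unique {k = k} (m≤m+n _ _) t<2^k))
    (cong (λ m → take (h t) (drop (sumRange h (phaseStart k) m) (sphere v (2 ^ k)))) (m+n∸m≡n (phaseStart k) n))
    where
    t = phaseStart k + n

module Play (v : Vertex) (f : FSeq) where
  open SphereStrategy v
  open Fire v σ f

  Protected⇒∈earlier : ∀ {t x} → Protected σ f t x → x ∈ earlier f t
  Protected⇒∈earlier {suc t} (inj₁ p) = ∈-++⁺ˡ (Protected⇒∈earlier p)
  Protected⇒∈earlier {suc t} {x} (inj₂ x∈move) =
    ∈-++⁺ʳ (earlier f t) (proj₁ (∈-filter⁻ (new? f t) {xs = segment f t} (subst (x ∈_) (move-σ f t) x∈move)))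

  ∈earlier⇒Protected : ∀ {t x} → x ∈ earlier f t → Protected σ f t x
  ∈earlier⇒Protected {suc t} {x} x∈ with ∈-++⁻ (earlier f t) x∈ | x ∈? earlier f t
  ... | inj₁ x∈earlier | _              = inj₁ (∈earlier⇒Protected x∈earlier)
  ... | inj₂ _         | yes x∈earlier  = inj₁ (∈earlier⇒Protected x∈earlier)
  ... | inj₂ x∈segment | no  x∉earlier  =
    inj₂ (subst (x ∈_) (sym (move-σ f t)) (∈-filter⁺ (new? f t) x∈segment x∉earlier))

  Protected? : ∀ t x → Dec (Protected σ f t x)
  Protected? t x = map′ ∈earlier⇒Protected Protected⇒∈earlier (x ∈? earlier f t)

  ∈segment⇒Protected : ∀ {t x} → x ∈ segment f t → Protected σ f (suc t) x
  ∈segment⇒Protected {t} x∈ = ∈earlier⇒Protected (∈-++⁺ʳ (earlier f t) x∈)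

  legal : ∀ t → LegalAt v σ f t
  legal t = subst (λ M → length M ≤ f t × All (λ x → ¬ Burning v σ f t x × ¬ Protected σ f t x) M)
    (sym (move-σ f t)) (few , All.tabulate fresh)
    where
    few : length (response f t) ≤ f t
    few = ≤-trans (length-filter (new? f t) (segment f t)) (≤-trans (≤-reflexive (length-take (f t) _)) (m⊓n≤m _ _))
    fresh : ∀ {x} → x ∈ response f t → ¬ Burning v σ f t x × ¬ Protected σ f t x
    fresh {x} x∈ with x∈segment , x∉earlier ← ∈-filter⁻ (new? f t) {xs = segment f t} x∈ =
      (λ b → <⇒≱ (proj₂ (phase-bounds t)) (subst (_≤ t) (All.lookup (segment-dist f t) x∈segment) (Burning⇒dist≤ b))) ,
      (λ p → x∉earlier (Protected⇒∈earlier p))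

  sphere-prefix-protected : ∀ k {n} → n ≤ 2 ^ k ∸ phaseStart k →
    All (Protected σ f (phaseStart k + n)) (take (sumRange f (phaseStart k) n) (sphere v (2 ^ k)))
  sphere-prefix-protected k {zero}  _    = []
  sphere-prefix-protected k {suc n} n<Δ =
    subst (λ t → All (Protected σ f t) (take (sumRange f s (suc n)) S)) (sym (+-suc s n))
      (subst (All (Protected σ f (suc t))) (sym (take-+ (sumRange f s n) (f t) S)) (All.++⁺ old new))
    where
    s = phaseStart k
    S = sphere v (2 ^ k)
    t = s + n
    t<2^k : t < 2 ^ k
    t<2^k = subst (t <_) (m+[n∸m]≡n (phaseStart≤2^k k)) (+-monoʳ-< s n<Δ)
    old : All (Protected σ f (suc t)) (take (sumRange f s n) S)
    old = All.map inj₁ (sphere-prefix-protected k (<⇒≤ n<Δ))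
    new : All (Protected σ f (suc t)) (take (f t) (drop (sumRange f s n) S))
    new = subst (All (Protected σ f (suc t))) (segment-in-phase f k t<2^k) (All.tabulate ∈segment⇒Protected)

  sufficient⇒fenced : ∀ {k} → Sufficient f k → ∀ x → dist x v ≡ 2 ^ k → Protected σ f (2 ^ k) x
  sufficient⇒fenced {k} enough x d≡2^k =
    subst (λ t → Protected σ f t x) (m+[n∸m]≡n (phaseStart≤2^k k)) (All.lookup whole x∈S)
    where
    S = sphere v (2 ^ k)
    whole : All (Protected σ f (phaseStart k + (2 ^ k ∸ phaseStart k))) S
    whole = subst (All _) (take-all _ S (≤-trans (≤-reflexive (length-sphere v (2 ^ k))) enough))
      (sphere-prefix-protected k ≤-refl)
    x∈S : x ∈ S
    x∈S = subst (λ R → x ∈ sphere v R) d≡2^k (∈-sphere⁺ v (subst (1 ≤_) (sym d≡2^k) (m^n>0 2 k)))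

theorem3 : (v : Vertex) → Σ Strategy (λ σ → (f : FSeq) → Condition16 f → Player1Wins v σ f)
theorem3 v = σ , wins
  where
  open SphereStrategy v using (σ)
  wins : (f : FSeq) → Condition16 f → Player1Wins v σ f
  wins f condition =
    let k , enough = sufficient-phase f condition
    in Fire.fenced⇒wins v σ f (Play.legal v f) (Play.Protected? v f) (m^n>0 2 k) (Play.sufficient⇒fenced v f {k} enough)
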